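{- Let $q$ be an odd integer with $q \equiv 1 \pmod 4$, and let $s = q-2$ (so $s$ is an odd integer with $s \equiv 3 \pmod 4$). If there exists a skew Hadamard matrix of order $s+1$ and there exists a circulant conference matrix of order $q$, then there exists a Hadamard matrix of order $2q(s+1)$.
   Context: A Hadamard matrix of order $n$ is an $n\times n$ matrix $H$ with entries in $\{ -1,1\}$ such that $HH^T = H^TH = nI_n$. A skew Hadamard matrix is a Hadamard matrix $H$ of the form $H = S + I$ with $S$ skew-symmetric ($S^T=-S$). Write $J_q$ for the $q\times q$ all-ones matrix. In this paper a conference matrix of order $q$ means a $q\times q$ matrix $C_q$ with zero diagonal, entries $\pm 1$ off the diagonal, satisfying $C_qC_q^T = qI_q - J_q$ and $C_qJ_q = J_qC_q = 0$ (for example, for a prime power $q$, the matrix $C_q=[\chi(\alpha_j-\alpha_i)]_{i,j}$ where $\chi$ is the quadratic character of $GF(q)=\{\alpha_1,\dots,\alpha_q\}$ with $\chi(0)=0$). A matrix is circulant if each row is the cyclic shift by one position to the right of the previous row. -}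

module Defs where

open import Data.Nat using (ℕ; zero; suc)
open import Data.Fin using (Fin; zero; suc)
open import Data.Integer using (ℤ; +_; -_; _+_; _-_; _*_; 0ℤ; 1ℤ)
open import Data.Product using (_×_)
open import Data.Sum using (_⊎_)
open import Relation.Binary.PropositionalEquality using (_≡_; _≢_)
open import Data.Fin using (toℕ; fromℕ<)
open import Data.Nat using (_<_) renaming (_+_ to _+ℕ_)
open import Data.Nat.DivMod using (_%_; m%n<n)

Matrix : ℕ → Set
Matrix n = Fin n → Fin n → ℤ

∑ : (n : ℕ) → (Fin n → ℤ) → ℤ
∑ zero    f = 0ℤ
∑ (suc n) f = f zero + ∑ n (λ k → f (suc k))

transpose : ∀ {n} → Matrix n → Matrix n
transpose A i j = A j i

mul : ∀ {n} → Matrix n → Matrix n → Matrix n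
mul {n} A B i j = ∑ n (λ k → A i k * B k j)

δ : ∀ {n} → Fin n → Fin n → ℤ
δ zero    zero    = 1ℤ
δ zero    (suc j) = 0ℤ
δ (suc i) zero    = 0ℤ
δ (suc i) (suc j) = δ i j

I : ∀ n → Matrix n
I n = δ

J : ∀ n → Matrix n
J n i j = 1ℤ

scale : ∀ {n} → ℤ → Matrix n → Matrix n
scale c A i j = c * A i j

_⊕_ : ∀ {n} → Matrix n → Matrix n → Matrix n
(A ⊕ B) i j = A i j + B i j

_⊖_ : ∀ {n} → Matrix n → Matrix n → Matrix n
(A ⊖ B) i j = A i j - B i j

negM : ∀ {n} → Matrix n → Matrix n
negM A i j = - A i j

Zero : ∀ n → Matrix n
Zero n i j = 0ℤ

IsPM1 : ℤ → Set
IsPM1 x = (x ≡ 1ℤ) ⊎ (x ≡ - 1ℤ)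

IsHadamard : ∀ n → Matrix n → Set
IsHadamard n H =
  (∀ i j → IsPM1 (H i j)) ×
  (∀ i j → mul H (transpose H) i j ≡ scale (+ n) (I n) i j) ×
  (∀ i j → mul (transpose H) H i j ≡ scale (+ n) (I n) i j)

IsSkewSymmetric : ∀ {n} → Matrix n → Set
IsSkewSymmetric S = ∀ i j → transpose S i j ≡ negM S i j

IsSkewHadamard : ∀ n → Matrix n → Set
IsSkewHadamard n H =
  IsHadamard n H × IsSkewSymmetric (H ⊖ I n)

IsConference : ∀ q → Matrix q → Set
IsConference q C =
  (∀ i → C i i ≡ 0ℤ) ×
  (∀ i j → i ≢ j → IsPM1 (C i j)) ×
  (∀ i j → mul C (transpose C) i j ≡ (scale (+ q) (I q) ⊖ J q) i j) ×
  (∀ i j → mul C (J q) i j ≡ 0ℤ) ×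
  (∀ i j → mul (J q) C i j ≡ 0ℤ)

next : ∀ {n} → Fin n → Fin n
next {suc n} j = fromℕ< (m%n<n (suc (toℕ j)) (suc n))

-- circulant: row i+1 is row i cyclically shifted one position to the right,
-- i.e. A (i+1) (j+1 mod n) = A i j for every row i with i+1 < n
IsCirculant : ∀ n → Matrix n → Set
IsCirculant n A =
  ∀ (i : Fin n) (p : suc (toℕ i) < n) (j : Fin n) →
    A (fromℕ< p) (next j) ≡ A i j

-- A conference matrix C of order q ≡ 1 (mod 4) is symmetric: for i ≠ j the rows give
-- Σₖ (1 + Cᵢₖ)(1 + Cⱼₖ) = q − 1, and every summand with k ∉ {i, j} is 0 or 4, so
-- Cᵢⱼ + Cⱼᵢ ≡ q − 3 ≡ 2 (mod 4), which rules out Cⱼᵢ = −Cᵢⱼ.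
-- Let S = H − I be the core of the skew Hadamard matrix H of order n = q − 1, so that Sᵀ = −S
-- and SSᵀ = (n − 1) I, and put
--   [ (I + C) ⊗ S + J ⊗ I            (C − I) ⊗ S + (J − 2I) ⊗ I ]
--   [ (C − I) ⊗ S − (J − 2I) ⊗ I     −(I + C) ⊗ S + J ⊗ I       ]  =  Σₜ Pₜ ⊗ Aₜ ⊗ Bₜ
-- with Aₜ ∈ {I, C, J}, Bₜ ∈ {S, I} and 2 × 2 integer coefficient matrices Pₜ.  Its entries are
-- ±1 because C and S have zero diagonal and ±1 entries elsewhere.  By the mixed-product rule
-- its Gram matrix is Σₛₜ PₛPₜᵀ ⊗ AₛAₜᵀ ⊗ BₛBₜᵀ; the relations CCᵀ = qI − J, CJ = 0 and
-- SSᵀ = (n − 1) I express every AₛAₜᵀ and BₛBₜᵀ through I, C, J and S, and collecting terms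
-- gives 2qn I.  The transpose has the same form (Aₜ is symmetric and Bₜᵀ = ±Bₜ), so the same
-- computation gives the column condition.
module Submission where

open import Defs
open import Data.Nat using (ℕ; _*_; _∸_)
open import Data.Nat.DivMod using (_%_)
open import Data.Product using (Σ; _×_)
open import Relation.Binary.PropositionalEquality using (_≡_)

import Data.Nat as ℕ
open import Data.Nat.DivMod using (_/_; m≡m%n+[m/n]*n)
open import Data.Nat.Divisibility using (∣⇒≤)
open import Data.Fin using (Fin; zero; suc; _↑ˡ_; _↑ʳ_; combine; quotient; remainder; _≟_)
open import Data.Fin.Patterns using (0F; 1F; 2F; 3F)
open import Data.Fin.Properties using (remQuot-combine; combine-surjective; combine-injective)
open import Data.Integer using (ℤ; +_; -[1+_]; 0ℤ; 1ℤ; -1ℤ; _+_; _-_; -_) renaming (_*_ to _·_)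
import Data.Integer.Properties as ℤ
open import Data.Integer.Divisibility.Signed
  using (_∣_; divides; ∣-refl; ∣m⇒∣m*n; ∣m∣n⇒∣m+n; ∣m∣n⇒∣m-n; ∣⇒∣ᵤ)
open import Data.Integer.Tactic.RingSolver using (solve-∀)
open import Data.Product using (_,_; proj₁; proj₂; ∃-syntax)
open import Data.Sum using (_⊎_; inj₁; inj₂)
open import Data.Empty using (⊥-elim)
open import Function using (_∘_)
open import Relation.Nullary using (yes; no; ¬_)
open import Relation.Binary.PropositionalEquality
  using (refl; sym; trans; cong; cong₂; subst; _≢_; module ≡-Reasoning)
open import Algebra.Properties.Semiring.Sum ℤ.+-*-semiring
  using (sum; sum-cong-≗; sum-replicate-zero; ∑-distrib-+; ∑-comm; *-distribˡ-sum; *-distribʳ-sum)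
open import Algebra.Properties.CommutativeSemigroup ℤ.*-commutativeSemigroup using (interchange)

open ≡-Reasoning

∑≡sum : ∀ n (f : Fin n → ℤ) → ∑ n f ≡ sum f
∑≡sum ℕ.zero    f = refl
∑≡sum (ℕ.suc n) f = cong (_+_ (f zero)) (∑≡sum n (f ∘ suc))

sum-one : ∀ n → sum {n} (λ _ → 1ℤ) ≡ + n
sum-one ℕ.zero    = refl
sum-one (ℕ.suc n) = cong (_+_ 1ℤ) (sum-one n)

sum-neg : ∀ {n} (f : Fin n → ℤ) → sum (λ k → - f k) ≡ - sum f
sum-neg f = begin
  sum (λ k → - f k)      ≡⟨ sum-cong-≗ (λ k → sym (ℤ.-1*i≡-i (f k))) ⟩
  sum (λ k → -1ℤ · f k)  ≡⟨ sym (*-distribˡ-sum -1ℤ f) ⟩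
  -1ℤ · sum f            ≡⟨ ℤ.-1*i≡-i (sum f) ⟩
  - sum f                ∎

sum-sub : ∀ {n} (f g : Fin n → ℤ) → sum (λ k → f k - g k) ≡ sum f - sum g
sum-sub f g = trans (∑-distrib-+ f (λ k → - g k)) (cong (_+_ (sum f)) (sum-neg g))

∑-distrib-+₄ : ∀ {n} (f g h e : Fin n → ℤ) →
  sum (λ k → f k + (g k + (h k + e k))) ≡ sum f + (sum g + (sum h + sum e))
∑-distrib-+₄ f g h e =
  trans (∑-distrib-+ f _) (cong (_+_ (sum f))
    (trans (∑-distrib-+ g _) (cong (_+_ (sum g)) (∑-distrib-+ h e))))

sum-*-sum : ∀ {m n} (f : Fin m → ℤ) (g : Fin n → ℤ) →
  sum (λ i → sum (λ j → f i · g j)) ≡ sum f · sum g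
sum-*-sum f g = begin
  sum (λ i → sum (λ j → f i · g j)) ≡⟨ sum-cong-≗ (λ i → sym (*-distribˡ-sum (f i) g)) ⟩
  sum (λ i → f i · sum g)           ≡⟨ sym (*-distribʳ-sum (sum g) f) ⟩
  sum f · sum g                     ∎

sum-↑ˡ-↑ʳ : ∀ m n (f : Fin (m ℕ.+ n) → ℤ) →
  sum f ≡ sum (λ i → f (i ↑ˡ n)) + sum (λ j → f (m ↑ʳ j))
sum-↑ˡ-↑ʳ ℕ.zero    n f = sym (ℤ.+-identityˡ (sum f))
sum-↑ˡ-↑ʳ (ℕ.suc m) n f =
  trans (cong (_+_ (f zero)) (sum-↑ˡ-↑ʳ m n (f ∘ suc))) (sym (ℤ.+-assoc (f zero) _ _))

sum-combine : ∀ m n (f : Fin (m * n) → ℤ) →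
  sum f ≡ sum (λ (i : Fin m) → sum (λ (j : Fin n) → f (combine i j)))
sum-combine ℕ.zero    n f = refl
sum-combine (ℕ.suc m) n f =
  trans (sum-↑ˡ-↑ʳ n (m * n) f)
        (cong (_+_ (sum (λ j → f (j ↑ˡ m * n)))) (sum-combine m n (λ k → f (n ↑ʳ k))))

combine₃-surjective : ∀ {a b c} (x : Fin (a * b * c)) →
  ∃[ p ] ∃[ i ] ∃[ k ] combine (combine {a} {b} p i) k ≡ x
combine₃-surjective {a} {b} {c} x
  with u , k , refl ← combine-surjective {a * b} {c} x
  with p , i , refl ← combine-surjective {a} {b} u = p , i , k , refl

δ-refl : ∀ {n} (i : Fin n) → δ i i ≡ 1ℤ
δ-refl zero    = refl
δ-refl (suc i) = δ-refl i

δ-≢ : ∀ {n} {i j : Fin n} → i ≢ j → δ i j ≡ 0ℤ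
δ-≢ {i = zero}  {zero}  i≢j = ⊥-elim (i≢j refl)
δ-≢ {i = zero}  {suc j} i≢j = refl
δ-≢ {i = suc i} {zero}  i≢j = refl
δ-≢ {i = suc i} {suc j} i≢j = δ-≢ (i≢j ∘ cong suc)

δ-sym : ∀ {n} (i j : Fin n) → δ i j ≡ δ j i
δ-sym zero    zero    = refl
δ-sym zero    (suc j) = refl
δ-sym (suc i) zero    = refl
δ-sym (suc i) (suc j) = δ-sym i j

sum-δ : ∀ {n} (i : Fin n) (f : Fin n → ℤ) → sum (λ k → δ i k · f k) ≡ f i
sum-δ {ℕ.suc n} zero f = begin
  1ℤ · f zero + sum (λ k → 0ℤ · f (suc k))
    ≡⟨ cong₂ _+_ (ℤ.*-identityˡ (f zero)) (sum-cong-≗ (ℤ.*-zeroˡ ∘ f ∘ suc)) ⟩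
  f zero + sum {n} (λ _ → 0ℤ)
    ≡⟨ cong (_+_ (f zero)) (sum-replicate-zero n) ⟩
  f zero + 0ℤ
    ≡⟨ ℤ.+-identityʳ (f zero) ⟩
  f zero
    ∎
sum-δ (suc i) f = begin
  0ℤ · f zero + sum (λ k → δ i k · f (suc k)) ≡⟨ cong₂ _+_ (ℤ.*-zeroˡ (f zero)) (sum-δ i (f ∘ suc)) ⟩
  0ℤ + f (suc i)                              ≡⟨ ℤ.+-identityˡ (f (suc i)) ⟩
  f (suc i)                                   ∎

δ-combine : ∀ {m n} (i j : Fin m) (k l : Fin n) → δ (combine i k) (combine j l) ≡ δ i j · δ k l
δ-combine i j k l with i ≟ j | k ≟ l
... | yes refl | yes refl = trans (δ-refl (combine i k)) (sym (cong₂ _·_ (δ-refl i) (δ-refl k)))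
... | yes refl | no k≢l =
  trans (δ-≢ (k≢l ∘ proj₂ ∘ combine-injective i k i l))
        (sym (trans (cong (δ i i ·_) (δ-≢ k≢l)) (ℤ.*-zeroʳ (δ i i))))
... | no i≢j | _ =
  trans (δ-≢ (i≢j ∘ proj₁ ∘ combine-injective i k j l))
        (sym (trans (cong (_· δ k l) (δ-≢ i≢j)) (ℤ.*-zeroˡ (δ k l))))

mulᵀ : ∀ {n} → Matrix n → Matrix n → Matrix n
mulᵀ A B = mul A (transpose B)

mulᵀ-cong : ∀ {n} {A B : Matrix n} → (∀ x y → A x y ≡ B x y) → ∀ x y → mulᵀ A A x y ≡ mulᵀ B B x y
mulᵀ-cong {n} A≗B x y =
  trans (∑≡sum n _) (trans (sum-cong-≗ (λ z → cong₂ _·_ (A≗B x z) (A≗B y z))) (sym (∑≡sum n _)))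

mulᵀ-identityˡ : ∀ {n} (A : Matrix n) i j → mulᵀ (I n) A i j ≡ A j i
mulᵀ-identityˡ {n} A i j = trans (∑≡sum n _) (sum-δ i (A j))

mulᵀ-identityʳ : ∀ {n} (A : Matrix n) i j → mulᵀ A (I n) i j ≡ A i j
mulᵀ-identityʳ {n} A i j =
  trans (∑≡sum n _) (trans (sum-cong-≗ (λ k → ℤ.*-comm (A i k) (δ j k))) (sum-δ j (A i)))

mulᵀ-onesˡ : ∀ {n} (A : Matrix n) i j → mulᵀ (J n) A i j ≡ sum (A j)
mulᵀ-onesˡ {n} A i j = trans (∑≡sum n _) (sum-cong-≗ (ℤ.*-identityˡ ∘ A j))

mulᵀ-onesʳ : ∀ {n} (A : Matrix n) i j → mulᵀ A (J n) i j ≡ sum (A i)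
mulᵀ-onesʳ {n} A i j = trans (∑≡sum n _) (sum-cong-≗ (ℤ.*-identityʳ ∘ A i))

∑ᴹ : ∀ {T n} → (Fin T → Matrix n) → Matrix n
∑ᴹ F x y = sum (λ t → F t x y)

mulᵀ-∑ᴹ : ∀ {S T n} (F : Fin S → Matrix n) (G : Fin T → Matrix n) x y →
  mulᵀ (∑ᴹ F) (∑ᴹ G) x y ≡ sum (λ s → sum (λ t → mulᵀ (F s) (G t) x y))
mulᵀ-∑ᴹ {n = n} F G x y = begin
  mulᵀ (∑ᴹ F) (∑ᴹ G) x y
    ≡⟨ ∑≡sum n _ ⟩
  sum (λ z → ∑ᴹ F x z · ∑ᴹ G y z)
    ≡⟨ sum-cong-≗ (λ z → sym (sum-*-sum (λ s → F s x z) (λ t → G t y z))) ⟩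
  sum (λ z → sum (λ s → sum (λ t → F s x z · G t y z)))
    ≡⟨ ∑-comm (λ z s → sum (λ t → F s x z · G t y z)) ⟩
  sum (λ s → sum (λ z → sum (λ t → F s x z · G t y z)))
    ≡⟨ sum-cong-≗ (λ s → ∑-comm (λ z t → F s x z · G t y z)) ⟩
  sum (λ s → sum (λ t → sum (λ z → F s x z · G t y z)))
    ≡⟨ sum-cong-≗ (λ s → sum-cong-≗ (λ t → sym (∑≡sum n (λ z → F s x z · G t y z)))) ⟩
  sum (λ s → sum (λ t → mulᵀ (F s) (G t) x y))
    ∎

_⊗_ : ∀ {m n} → Matrix m → Matrix n → Matrix (m * n)
_⊗_ {m} {n} A B x y = A (quotient n x) (quotient n y) · B (remainder {m} n x) (remainder {m} n y)

⊗-combine : ∀ {m n} (A : Matrix m) (B : Matrix n) i j k l →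
  (A ⊗ B) (combine i k) (combine j l) ≡ A i j · B k l
⊗-combine A B i j k l =
  cong₂ _·_ (cong₂ A (cong proj₁ (remQuot-combine i k)) (cong proj₁ (remQuot-combine j l)))
            (cong₂ B (cong proj₂ (remQuot-combine i k)) (cong proj₂ (remQuot-combine j l)))

mulᵀ-⊗ : ∀ {m n} (A A' : Matrix m) (B B' : Matrix n) i j k l →
  mulᵀ (A ⊗ B) (A' ⊗ B') (combine i k) (combine j l) ≡ mulᵀ A A' i j · mulᵀ B B' k l
mulᵀ-⊗ {m} {n} A A' B B' i j k l = begin
  mulᵀ (A ⊗ B) (A' ⊗ B') (combine i k) (combine j l)
    ≡⟨ ∑≡sum (m * n) _ ⟩
  sum (λ z → (A ⊗ B) (combine i k) z · (A' ⊗ B') (combine j l) z)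
    ≡⟨ sum-combine m n _ ⟩
  sum (λ (u : Fin m) → sum (λ (v : Fin n) →
    (A ⊗ B) (combine i k) (combine u v) · (A' ⊗ B') (combine j l) (combine u v)))
    ≡⟨ sum-cong-≗ (λ u → sum-cong-≗ (λ v →
         trans (cong₂ _·_ (⊗-combine A B i u k v) (⊗-combine A' B' j u l v))
               (interchange (A i u) (B k v) (A' j u) (B' l v)))) ⟩
  sum (λ u → sum (λ v → (A i u · A' j u) · (B k v · B' l v)))
    ≡⟨ sum-*-sum (λ u → A i u · A' j u) (λ v → B k v · B' l v) ⟩
  sum (λ u → A i u · A' j u) · sum (λ v → B k v · B' l v)
    ≡⟨ sym (cong₂ _·_ (∑≡sum m _) (∑≡sum n _)) ⟩
  mulᵀ A A' i j · mulᵀ B B' k l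
    ∎

kronSum : ∀ {T a b c} → (Fin T → Matrix a) → (Fin T → Matrix b) → (Fin T → Matrix c) →
  Matrix (a * b * c)
kronSum P A B = ∑ᴹ (λ t → (P t ⊗ A t) ⊗ B t)

module _ {T a b c} (P : Fin T → Matrix a) (A : Fin T → Matrix b) (B : Fin T → Matrix c) where

  kronSum-combine : ∀ p p' i j k l →
    kronSum P A B (combine (combine p i) k) (combine (combine p' j) l)
      ≡ sum (λ t → (P t p p' · A t i j) · B t k l)
  kronSum-combine p p' i j k l = sum-cong-≗ (λ t →
    trans (⊗-combine (P t ⊗ A t) (B t) (combine p i) (combine p' j) k l)
          (cong (_· B t k l) (⊗-combine (P t) (A t) p p' i j)))

  mulᵀ-kronSum : ∀ p p' i j k l →
    mulᵀ (kronSum P A B) (kronSum P A B) (combine (combine p i) k) (combine (combine p' j) l)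
      ≡ sum (λ s → sum (λ t → (mulᵀ (P s) (P t) p p' · mulᵀ (A s) (A t) i j) · mulᵀ (B s) (B t) k l))
  mulᵀ-kronSum p p' i j k l =
    trans (mulᵀ-∑ᴹ (λ t → (P t ⊗ A t) ⊗ B t) (λ t → (P t ⊗ A t) ⊗ B t) _ _)
          (sum-cong-≗ (λ s → sum-cong-≗ (λ t →
            trans (mulᵀ-⊗ (P s ⊗ A s) (P t ⊗ A t) (B s) (B t) (combine p i) (combine p' j) k l)
                  (cong (_· mulᵀ (B s) (B t) k l) (mulᵀ-⊗ (P s) (P t) (A s) (A t) p p' i j)))))

  transpose-kronSum : (ε : Fin T → ℤ) →
    (∀ t i j → A t j i ≡ A t i j) → (∀ t k l → B t l k ≡ ε t · B t k l) →
    ∀ x y → transpose (kronSum P A B) x y ≡ kronSum (λ t → scale (ε t) (transpose (P t))) A B x y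
  transpose-kronSum ε A-symmetric B-signed x y = sum-cong-≗ λ t →
    trans (cong₂ (λ u v → (P t _ _ · u) · v) (A-symmetric t _ _) (B-signed t _ _))
          (move-scalar (P t _ _) _ _ (ε t))
    where
    move-scalar : ∀ p a b e → (p · a) · (e · b) ≡ ((e · p) · a) · b
    move-scalar = solve-∀

pm1-* : ∀ {x y} → IsPM1 x → IsPM1 y → IsPM1 (x · y)
pm1-* (inj₁ refl) (inj₁ refl) = inj₁ refl
pm1-* (inj₁ refl) (inj₂ refl) = inj₂ refl
pm1-* (inj₂ refl) (inj₁ refl) = inj₂ refl
pm1-* (inj₂ refl) (inj₂ refl) = inj₁ refl

pm1-equal-or-opposite : ∀ {x y} → IsPM1 x → IsPM1 y → x ≡ y ⊎ y ≡ - x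
pm1-equal-or-opposite (inj₁ refl) (inj₁ refl) = inj₁ refl
pm1-equal-or-opposite (inj₁ refl) (inj₂ refl) = inj₂ refl
pm1-equal-or-opposite (inj₂ refl) (inj₁ refl) = inj₂ refl
pm1-equal-or-opposite (inj₂ refl) (inj₂ refl) = inj₁ refl

DiagOrPM1 : ℤ → ℤ → Set
DiagOrPM1 d m = (d ≡ 1ℤ × m ≡ 0ℤ) ⊎ (d ≡ 0ℤ × IsPM1 m)

δ-diag-or-pm1 : ∀ {n} {M : Matrix n} → (∀ i → M i i ≡ 0ℤ) → (∀ i j → i ≢ j → IsPM1 (M i j)) →
  ∀ i j → DiagOrPM1 (δ i j) (M i j)
δ-diag-or-pm1 diagonal off-diagonal i j with i ≟ j
... | yes refl = inj₁ (δ-refl i , diagonal i)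
... | no i≢j   = inj₂ (δ-≢ i≢j , off-diagonal i j i≢j)

pm1-entry : ∀ {a b g e d c d' x} → IsPM1 a → IsPM1 b → IsPM1 g → IsPM1 (g + e) →
  DiagOrPM1 d c → DiagOrPM1 d' x →
  IsPM1 ((a · d) · x + ((b · c) · x + ((g · 1ℤ) · d' + ((e · d) · d' + 0ℤ))))
pm1-entry {a} {b} {g} {e} _ _ _ ±g+e (inj₁ (refl , refl)) (inj₁ (refl , refl)) =
  subst IsPM1 (both-diagonal a b g e) ±g+e
  where
  both-diagonal : ∀ a b g e →
    g + e ≡ (a · 1ℤ) · 0ℤ + ((b · 0ℤ) · 0ℤ + ((g · 1ℤ) · 1ℤ + ((e · 1ℤ) · 1ℤ + 0ℤ)))
  both-diagonal = solve-∀
pm1-entry {a} {b} {g} {e} ±a _ _ _ (inj₁ (refl , refl)) (inj₂ (refl , ±x)) =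
  subst IsPM1 (first-diagonal a b g e _) (pm1-* ±a ±x)
  where
  first-diagonal : ∀ a b g e x →
    a · x ≡ (a · 1ℤ) · x + ((b · 0ℤ) · x + ((g · 1ℤ) · 0ℤ + ((e · 1ℤ) · 0ℤ + 0ℤ)))
  first-diagonal = solve-∀
pm1-entry {a} {b} {g} {e} _ _ ±g _ (inj₂ (refl , _)) (inj₁ (refl , refl)) =
  subst IsPM1 (second-diagonal a b g e _) ±g
  where
  second-diagonal : ∀ a b g e c →
    g ≡ (a · 0ℤ) · 0ℤ + ((b · c) · 0ℤ + ((g · 1ℤ) · 1ℤ + ((e · 0ℤ) · 1ℤ + 0ℤ)))
  second-diagonal = solve-∀
pm1-entry {a} {b} {g} {e} _ ±b _ _ (inj₂ (refl , ±c)) (inj₂ (refl , ±x)) =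
  subst IsPM1 (neither-diagonal a b g e _ _) (pm1-* ±b (pm1-* ±c ±x))
  where
  neither-diagonal : ∀ a b g e c x →
    b · (c · x) ≡ (a · 0ℤ) · x + ((b · c) · x + ((g · 1ℤ) · 0ℤ + ((e · 0ℤ) · 0ℤ + 0ℤ)))
  neither-diagonal = solve-∀

∣-sum : ∀ {m n} {f : Fin n → ℤ} → (∀ k → m ∣ f k) → m ∣ sum f
∣-sum {m} {ℕ.zero}  _   = divides 0ℤ (sym (ℤ.*-zeroˡ m))
∣-sum {m} {ℕ.suc n} m∣f = ∣m∣n⇒∣m+n (m∣f zero) (∣-sum (m∣f ∘ suc))

4∣[1+x][1+y] : ∀ {x y} → IsPM1 x → IsPM1 y → + 4 ∣ (1ℤ + x) · (1ℤ + y)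
4∣[1+x][1+y] (inj₁ refl) (inj₁ refl) = divides 1ℤ refl
4∣[1+x][1+y] (inj₁ refl) (inj₂ refl) = divides 0ℤ refl
4∣[1+x][1+y] (inj₂ refl) _           = divides 0ℤ refl

4∤2 : ¬ (+ 4 ∣ + 2)
4∤2 4∣2 with ∣⇒≤ (∣⇒∣ᵤ 4∣2)
... | ℕ.s≤s (ℕ.s≤s ())

4∤4r-2 : ∀ r → ¬ (+ 4 ∣ + 4 · r - + 2)
4∤4r-2 r 4∣4r-2 = 4∤2 (subst (+ 4 ∣_) (cancel r) (∣m∣n⇒∣m-n (∣m⇒∣m*n r ∣-refl) 4∣4r-2))
  where
  cancel : ∀ r → + 4 · r - (+ 4 · r - + 2) ≡ + 2
  cancel = solve-∀

self-negative : ∀ {x} → x ≡ - x → x ≡ 0ℤ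
self-negative {+_ ℕ.zero}    _  = refl
self-negative {+_ (ℕ.suc m)} ()
self-negative { -[1+ m ]}    ()

module Conference {q} {C : Matrix q} (conference : IsConference q C) where

  diagonal : ∀ i → C i i ≡ 0ℤ
  diagonal = proj₁ conference

  off-diagonal : ∀ i j → i ≢ j → IsPM1 (C i j)
  off-diagonal = proj₁ (proj₂ conference)

  gram : ∀ i j → mulᵀ C C i j ≡ + q · δ i j - 1ℤ
  gram = proj₁ (proj₂ (proj₂ conference))

  row-sum : ∀ i → sum (C i) ≡ 0ℤ
  row-sum i = begin
    sum (C i)               ≡⟨ sum-cong-≗ (sym ∘ ℤ.*-identityʳ ∘ C i) ⟩
    sum (λ k → C i k · 1ℤ)  ≡⟨ sym (∑≡sum q (λ k → C i k · 1ℤ)) ⟩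
    mul C (J q) i i         ≡⟨ proj₁ (proj₂ (proj₂ (proj₂ conference))) i i ⟩
    0ℤ                      ∎

  shifted-rows : ∀ {i j} → i ≢ j → sum (λ k → (1ℤ + C i k) · (1ℤ + C j k)) ≡ + q - 1ℤ
  shifted-rows {i} {j} i≢j = begin
    sum (λ k → (1ℤ + C i k) · (1ℤ + C j k))
      ≡⟨ sum-cong-≗ (λ k → expand (C i k) (C j k)) ⟩
    sum (λ k → 1ℤ + (C i k + (C j k + C i k · C j k)))
      ≡⟨ ∑-distrib-+₄ (λ _ → 1ℤ) (C i) (C j) (λ k → C i k · C j k) ⟩
    sum {q} (λ _ → 1ℤ) + (sum (C i) + (sum (C j) + sum (λ k → C i k · C j k)))
      ≡⟨ cong₂ _+_ (sum-one q) (cong₂ _+_ (row-sum i) (cong₂ _+_ (row-sum j)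
           (trans (sym (∑≡sum q (λ k → C i k · C j k))) (gram i j)))) ⟩
    + q + (0ℤ + (0ℤ + (+ q · δ i j - 1ℤ)))
      ≡⟨ cong (λ d → + q + (0ℤ + (0ℤ + (+ q · d - 1ℤ)))) (δ-≢ i≢j) ⟩
    + q + (0ℤ + (0ℤ + (+ q · 0ℤ - 1ℤ)))
      ≡⟨ simplify (+ q) ⟩
    + q - 1ℤ
      ∎
    where
    expand : ∀ x y → (1ℤ + x) · (1ℤ + y) ≡ 1ℤ + (x + (y + x · y))
    expand = solve-∀
    simplify : ∀ q → q + (0ℤ + (0ℤ + (q · 0ℤ - 1ℤ))) ≡ q - 1ℤ
    simplify = solve-∀

  shifted-rows-mod-4 : ∀ {i j} → i ≢ j → + 4 ∣ (+ q - 1ℤ) - ((1ℤ + C j i) + (1ℤ + C i j))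
  shifted-rows-mod-4 {i} {j} i≢j = subst (+ 4 ∣_) total (∣-sum summand)
    where
    correction : Fin q → ℤ
    correction k = δ i k · (1ℤ + C j i) + δ j k · (1ℤ + C i j)

    summand : ∀ k → + 4 ∣ (1ℤ + C i k) · (1ℤ + C j k) - correction k
    summand k with i ≟ k | j ≟ k
    ... | yes refl | _ rewrite diagonal i | δ-refl i | δ-≢ (i≢j ∘ sym) =
      divides 0ℤ (at-i (C j i) (C i j))
      where
      at-i : ∀ a b → (1ℤ + 0ℤ) · (1ℤ + a) - (1ℤ · (1ℤ + a) + 0ℤ · (1ℤ + b)) ≡ 0ℤ · + 4
      at-i = solve-∀
    ... | no _ | yes refl rewrite diagonal j | δ-refl j | δ-≢ i≢j =
      divides 0ℤ (at-j (C j i) (C i j))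
      where
      at-j : ∀ a b → (1ℤ + b) · (1ℤ + 0ℤ) - (0ℤ · (1ℤ + a) + 1ℤ · (1ℤ + b)) ≡ 0ℤ · + 4
      at-j = solve-∀
    ... | no i≢k | no j≢k rewrite δ-≢ i≢k | δ-≢ j≢k =
      subst (+ 4 ∣_) (elsewhere _ (C j i) (C i j))
            (4∣[1+x][1+y] (off-diagonal i k i≢k) (off-diagonal j k j≢k))
      where
      elsewhere : ∀ p a b → p ≡ p - (0ℤ · (1ℤ + a) + 0ℤ · (1ℤ + b))
      elsewhere = solve-∀

    total : sum (λ k → (1ℤ + C i k) · (1ℤ + C j k) - correction k)
              ≡ (+ q - 1ℤ) - ((1ℤ + C j i) + (1ℤ + C i j))
    total = begin
      sum (λ k → (1ℤ + C i k) · (1ℤ + C j k) - correction k)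
        ≡⟨ sum-sub _ correction ⟩
      sum (λ k → (1ℤ + C i k) · (1ℤ + C j k)) - sum correction
        ≡⟨ cong₂ _-_ (shifted-rows i≢j)
             (trans (∑-distrib-+ (λ k → δ i k · (1ℤ + C j i)) (λ k → δ j k · (1ℤ + C i j)))
                    (cong₂ _+_ (sum-δ i (λ _ → 1ℤ + C j i)) (sum-δ j (λ _ → 1ℤ + C i j)))) ⟩
      (+ q - 1ℤ) - ((1ℤ + C j i) + (1ℤ + C i j))
        ∎

  symmetric : q % 4 ≡ 1 → ∀ i j → C j i ≡ C i j
  symmetric q≡1 i j with i ≟ j
  ... | yes refl = refl
  ... | no i≢j with pm1-equal-or-opposite (off-diagonal i j i≢j) (off-diagonal j i (i≢j ∘ sym))
  ... | inj₁ Cij≡Cji  = sym Cij≡Cji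
  ... | inj₂ Cji≡-Cij = ⊥-elim (4∤4r-2 r (subst (+ 4 ∣_) residue (shifted-rows-mod-4 i≢j)))
    where
    r = + (q / 4)
    q≡1+4r : + q ≡ 1ℤ + + 4 · r
    q≡1+4r = trans (cong +_ (trans (m≡m%n+[m/n]*n q 4) (cong (ℕ._+ (q / 4) * 4) q≡1)))
                   (trans (ℤ.pos-+ 1 _) (cong (_+_ 1ℤ) (trans (ℤ.pos-* (q / 4) 4) (ℤ.*-comm r (+ 4)))))
    cancel : ∀ r c → ((1ℤ + + 4 · r) - 1ℤ) - ((1ℤ + - c) + (1ℤ + c)) ≡ + 4 · r - + 2
    cancel = solve-∀
    residue : (+ q - 1ℤ) - ((1ℤ + C j i) + (1ℤ + C i j)) ≡ + 4 · r - + 2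
    residue = trans (cong₂ (λ q' c → (q' - 1ℤ) - ((1ℤ + c) + (1ℤ + C i j))) q≡1+4r Cji≡-Cij)
                    (cancel r (C i j))

mulᵀ-shift : ∀ {n} (A : Matrix n) k l →
  mulᵀ (A ⊖ I n) (A ⊖ I n) k l ≡ mulᵀ A A k l + (- A l k + (- A k l + δ k l))
mulᵀ-shift {n} A k l = begin
  mulᵀ (A ⊖ I n) (A ⊖ I n) k l
    ≡⟨ ∑≡sum n _ ⟩
  sum (λ p → (A k p - δ k p) · (A l p - δ l p))
    ≡⟨ sum-cong-≗ (λ p → expand (A k p) (δ k p) (A l p) (δ l p)) ⟩
  sum (λ p → A k p · A l p + (δ k p · - A l p + (δ l p · - A k p + δ k p · δ l p)))
    ≡⟨ ∑-distrib-+₄ (λ p → A k p · A l p) (λ p → δ k p · - A l p)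
                    (λ p → δ l p · - A k p) (λ p → δ k p · δ l p) ⟩
  sum (λ p → A k p · A l p)
    + (sum (λ p → δ k p · - A l p) + (sum (λ p → δ l p · - A k p) + sum (λ p → δ k p · δ l p)))
    ≡⟨ cong₂ _+_ (sym (∑≡sum n _)) (cong₂ _+_ (sum-δ k (λ p → - A l p))
         (cong₂ _+_ (sum-δ l (λ p → - A k p)) (trans (sum-δ k (δ l)) (δ-sym l k)))) ⟩
  mulᵀ A A k l + (- A l k + (- A k l + δ k l))
    ∎
  where
  expand : ∀ a d a' d' → (a - d) · (a' - d') ≡ a · a' + (d · - a' + (d' · - a + d · d'))
  expand = solve-∀

module SkewCore {n} {H : Matrix n} (skew-hadamard : IsSkewHadamard n H) where

  S : Matrix n
  S = H ⊖ I n

  skew : ∀ k l → S l k ≡ - S k l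
  skew = proj₂ skew-hadamard

  diagonal : ∀ k → S k k ≡ 0ℤ
  diagonal k = self-negative (skew k k)

  off-diagonal : ∀ k l → k ≢ l → IsPM1 (S k l)
  off-diagonal k l k≢l =
    subst IsPM1 (sym (trans (cong (_-_ (H k l)) (δ-≢ k≢l)) (ℤ.+-identityʳ (H k l))))
          (proj₁ (proj₁ skew-hadamard) k l)

  gram : ∀ k l → mulᵀ S S k l ≡ (+ n - 1ℤ) · δ k l
  gram k l = begin
    mulᵀ S S k l
      ≡⟨ mulᵀ-shift H k l ⟩
    mulᵀ H H k l + (- H l k + (- H k l + δ k l))
      ≡⟨ cong₂ (λ g h → g + (- h + (- H k l + δ k l)))
               (proj₁ (proj₂ (proj₁ skew-hadamard)) k l) transposed ⟩
    + n · δ k l + (- (δ k l - S k l) + (- H k l + δ k l))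
      ≡⟨ collect (+ n) (H k l) (δ k l) ⟩
    (+ n - 1ℤ) · δ k l
      ∎
    where
    un-shift : ∀ h d → h ≡ d + (h - d)
    un-shift = solve-∀
    transposed : H l k ≡ δ k l - S k l
    transposed = trans (un-shift (H l k) (δ l k)) (cong₂ _+_ (δ-sym l k) (skew k l))
    collect : ∀ N h d → N · d + (- (d - (h - d)) + (- h + d)) ≡ (N - 1ℤ) · d
    collect = solve-∀

data QFactor : Set where
  Iq Cq Jq : QFactor

data NFactor : Set where
  Sn In : NFactor

qGram : QFactor → QFactor → (q d c : ℤ) → ℤ
qGram Iq Iq q d c = d
qGram Iq Cq q d c = c
qGram Iq Jq q d c = 1ℤ
qGram Cq Iq q d c = c
qGram Cq Cq q d c = q · d - 1ℤ
qGram Cq Jq q d c = 0ℤ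
qGram Jq Iq q d c = 1ℤ
qGram Jq Cq q d c = 0ℤ
qGram Jq Jq q d c = q

nGram : NFactor → NFactor → (n d x : ℤ) → ℤ
nGram Sn Sn n d x = (n - 1ℤ) · d
nGram Sn In n d x = x
nGram In Sn n d x = - x
nGram In In n d x = d

sign : NFactor → ℤ
sign Sn = -1ℤ
sign In = 1ℤ

mat₂ : ℤ → ℤ → ℤ → ℤ → Matrix 2
mat₂ a b c d 0F 0F = a
mat₂ a b c d 0F 1F = b
mat₂ a b c d 1F 0F = c
mat₂ a b c d 1F 1F = d

coefficient : Fin 4 → Matrix 2
coefficient 0F = mat₂ 1ℤ -1ℤ -1ℤ -1ℤ
coefficient 1F = mat₂ 1ℤ 1ℤ 1ℤ -1ℤ
coefficient 2F = mat₂ 1ℤ 1ℤ -1ℤ 1ℤ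
coefficient 3F = mat₂ 0ℤ (- + 2) (+ 2) 0ℤ

qFactor : Fin 4 → QFactor
qFactor 0F = Iq
qFactor 1F = Cq
qFactor 2F = Jq
qFactor 3F = Iq

nFactor : Fin 4 → NFactor
nFactor 0F = Sn
nFactor 1F = Sn
nFactor 2F = In
nFactor 3F = In

coefficientᵀ : Fin 4 → Matrix 2
coefficientᵀ t = scale (sign (nFactor t)) (transpose (coefficient t))

-- The left-hand side is
--   sum (λ s → sum (λ u → (k s u · qGram (qFactor s) (qFactor u) (1ℤ + t) d c)
--                          · nGram (nFactor s) (nFactor u) t d' x))
-- unfolded, so that solve-∀ can read it; the two are equal by definition.
GramIdentity : (Fin 4 → Fin 4 → ℤ) → ℤ → Set
GramIdentity k r = ∀ t d c d' x →
    ((k 0F 0F · d) · ((t - 1ℤ) · d') + ((k 0F 1F · c) · ((t - 1ℤ) · d')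
      + ((k 0F 2F · 1ℤ) · x + ((k 0F 3F · d) · x + 0ℤ))))
  + (((k 1F 0F · c) · ((t - 1ℤ) · d') + ((k 1F 1F · ((1ℤ + t) · d - 1ℤ)) · ((t - 1ℤ) · d')
      + ((k 1F 2F · 0ℤ) · x + ((k 1F 3F · c) · x + 0ℤ))))
  + (((k 2F 0F · 1ℤ) · - x + ((k 2F 1F · 0ℤ) · - x
      + ((k 2F 2F · (1ℤ + t)) · d' + ((k 2F 3F · 1ℤ) · d' + 0ℤ))))
  + (((k 3F 0F · d) · - x + ((k 3F 1F · c) · - x
      + ((k 3F 2F · 1ℤ) · d' + ((k 3F 3F · d) · d' + 0ℤ))))
  + 0ℤ)))
  ≡ (+ 2 · (1ℤ + t) · t) · ((r · d) · d')

OrthogonalCoefficients : (Fin 4 → Matrix 2) → Set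
OrthogonalCoefficients P = ∀ b b' → GramIdentity (λ s u → mulᵀ (P s) (P u) b b') (δ b b')

coefficient-orthogonal : OrthogonalCoefficients coefficient
coefficient-orthogonal 0F 0F = solve-∀
coefficient-orthogonal 0F 1F = solve-∀
coefficient-orthogonal 1F 0F = solve-∀
coefficient-orthogonal 1F 1F = solve-∀

coefficientᵀ-orthogonal : OrthogonalCoefficients coefficientᵀ
coefficientᵀ-orthogonal 0F 0F = solve-∀
coefficientᵀ-orthogonal 0F 1F = solve-∀
coefficientᵀ-orthogonal 1F 0F = solve-∀
coefficientᵀ-orthogonal 1F 1F = solve-∀

coefficient-pm1 : ∀ b b' → IsPM1 (coefficient 0F b b') × IsPM1 (coefficient 1F b b')
                         × IsPM1 (coefficient 2F b b') × IsPM1 (coefficient 2F b b' + coefficient 3F b b')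
coefficient-pm1 0F 0F = inj₁ refl , inj₁ refl , inj₁ refl , inj₁ refl
coefficient-pm1 0F 1F = inj₂ refl , inj₁ refl , inj₁ refl , inj₂ refl
coefficient-pm1 1F 0F = inj₂ refl , inj₁ refl , inj₂ refl , inj₁ refl
coefficient-pm1 1F 1F = inj₂ refl , inj₂ refl , inj₁ refl , inj₁ refl

module Construction {n} {C : Matrix (ℕ.suc n)} {H : Matrix n}
  (conference : IsConference (ℕ.suc n) C) (C-symmetric : ∀ i j → C j i ≡ C i j)
  (skew-hadamard : IsSkewHadamard n H) where

  private
    q = ℕ.suc n
    module Conf = Conference conference
    module Core = SkewCore skew-hadamard
    open Core using (S)

  ⟦_⟧q : QFactor → Matrix q
  ⟦ Iq ⟧q = I q
  ⟦ Cq ⟧q = C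
  ⟦ Jq ⟧q = J q

  ⟦_⟧n : NFactor → Matrix n
  ⟦ Sn ⟧n = S
  ⟦ In ⟧n = I n

  q-gram : ∀ u v i j → mulᵀ ⟦ u ⟧q ⟦ v ⟧q i j ≡ qGram u v (+ q) (δ i j) (C i j)
  q-gram Iq Iq i j = trans (mulᵀ-identityˡ (I q) i j) (δ-sym j i)
  q-gram Iq Cq i j = trans (mulᵀ-identityˡ C i j) (C-symmetric i j)
  q-gram Iq Jq i j = mulᵀ-identityˡ (J q) i j
  q-gram Cq Iq i j = mulᵀ-identityʳ C i j
  q-gram Cq Cq i j = Conf.gram i j
  q-gram Cq Jq i j = trans (mulᵀ-onesʳ C i j) (Conf.row-sum i)
  q-gram Jq Iq i j = mulᵀ-identityʳ (J q) i j
  q-gram Jq Cq i j = trans (mulᵀ-onesˡ C i j) (Conf.row-sum j)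
  q-gram Jq Jq i j = trans (mulᵀ-onesˡ (J q) i j) (sum-one q)

  n-gram : ∀ u v k l → mulᵀ ⟦ u ⟧n ⟦ v ⟧n k l ≡ nGram u v (+ n) (δ k l) (S k l)
  n-gram Sn Sn k l = Core.gram k l
  n-gram Sn In k l = mulᵀ-identityʳ S k l
  n-gram In Sn k l = trans (mulᵀ-identityˡ S k l) (Core.skew k l)
  n-gram In In k l = trans (mulᵀ-identityˡ (I n) k l) (δ-sym l k)

  q-symmetric : ∀ u i j → ⟦ u ⟧q j i ≡ ⟦ u ⟧q i j
  q-symmetric Iq i j = δ-sym j i
  q-symmetric Cq i j = C-symmetric i j
  q-symmetric Jq i j = refl

  n-signed : ∀ v k l → ⟦ v ⟧n l k ≡ sign v · ⟦ v ⟧n k l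
  n-signed Sn k l = trans (Core.skew k l) (sym (ℤ.-1*i≡-i (S k l)))
  n-signed In k l = trans (δ-sym l k) (sym (ℤ.*-identityˡ (δ k l)))

  A : Fin 4 → Matrix q
  A = ⟦_⟧q ∘ qFactor

  B : Fin 4 → Matrix n
  B = ⟦_⟧n ∘ nFactor

  mulᵀ-construction : ∀ P → OrthogonalCoefficients P →
    ∀ x y → mulᵀ (kronSum P A B) (kronSum P A B) x y ≡ scale (+ (2 * q * n)) (I (2 * q * n)) x y
  mulᵀ-construction P orthogonal x y
    with b , i , k , refl ← combine₃-surjective {2} {q} {n} x
       | b' , j , l , refl ← combine₃-surjective {2} {q} {n} y = begin
    mulᵀ (kronSum P A B) (kronSum P A B) (combine (combine b i) k) (combine (combine b' j) l)
      ≡⟨ mulᵀ-kronSum P A B b b' i j k l ⟩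
    sum (λ s → sum (λ t → (mulᵀ (P s) (P t) b b' · mulᵀ (A s) (A t) i j) · mulᵀ (B s) (B t) k l))
      ≡⟨ sum-cong-≗ (λ s → sum-cong-≗ (λ t → cong₂ (λ g h → (mulᵀ (P s) (P t) b b' · g) · h)
           (q-gram (qFactor s) (qFactor t) i j) (n-gram (nFactor s) (nFactor t) k l))) ⟩
    sum (λ s → sum (λ t → (mulᵀ (P s) (P t) b b' · qGram (qFactor s) (qFactor t) (+ q) (δ i j) (C i j))
                            · nGram (nFactor s) (nFactor t) (+ n) (δ k l) (S k l)))
      ≡⟨ orthogonal b b' (+ n) (δ i j) (C i j) (δ k l) (S k l) ⟩
    (+ 2 · + q · + n) · ((δ b b' · δ i j) · δ k l)
      ≡⟨ sym (cong₂ _·_ order (trans (δ-combine (combine b i) (combine b' j) k l)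
                                     (cong (_· δ k l) (δ-combine b b' i j)))) ⟩
    scale (+ (2 * q * n)) (I (2 * q * n)) (combine (combine b i) k) (combine (combine b' j) l)
      ∎
    where
    order : + (2 * q * n) ≡ + 2 · + q · + n
    order = trans (ℤ.pos-* (2 * q) n) (cong (_· + n) (ℤ.pos-* 2 q))

  hadamard-matrix : Matrix (2 * q * n)
  hadamard-matrix = kronSum coefficient A B

  entries-pm1 : ∀ x y → IsPM1 (hadamard-matrix x y)
  entries-pm1 x y
    with b , i , k , refl ← combine₃-surjective {2} {q} {n} x
       | b' , j , l , refl ← combine₃-surjective {2} {q} {n} y
    with ±a , ±b , ±g , ±g+e ← coefficient-pm1 b b' =
    subst IsPM1 (sym (kronSum-combine coefficient A B b b' i j k l))
      (pm1-entry ±a ±b ±g ±g+e (δ-diag-or-pm1 Conf.diagonal Conf.off-diagonal i j)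
                               (δ-diag-or-pm1 Core.diagonal Core.off-diagonal k l))

  transpose-hadamard-matrix : ∀ x y → transpose hadamard-matrix x y ≡ kronSum coefficientᵀ A B x y
  transpose-hadamard-matrix =
    transpose-kronSum coefficient A B (sign ∘ nFactor) (q-symmetric ∘ qFactor) (n-signed ∘ nFactor)

  hadamard : IsHadamard (2 * q * n) hadamard-matrix
  hadamard = entries-pm1
           , mulᵀ-construction coefficient coefficient-orthogonal
           , λ x y → trans (mulᵀ-cong transpose-hadamard-matrix x y)
                           (mulᵀ-construction coefficientᵀ coefficientᵀ-orthogonal x y)

theorem3p1 : (q : ℕ) → q % 4 ≡ 1 →
    Σ (Matrix (q ∸ 1)) (IsSkewHadamard (q ∸ 1)) →
    Σ (Matrix q) (λ C → IsConference q C × IsCirculant q C) →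
    Σ (Matrix (2 * q * (q ∸ 1))) (IsHadamard (2 * q * (q ∸ 1)))
theorem3p1 ℕ.zero () _ _
theorem3p1 (ℕ.suc n) q≡1 (H , skew-hadamard) (C , conference , _) = hadamard-matrix , hadamard
  where open Construction conference (Conference.symmetric conference q≡1) skew-hadamard
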